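{- Let $G$ be a graph and $v$ a vertex of $G$. Then $st_{id}(G)\le st_{id}(G-v)+1$.
   Context: All graphs are finite and simple. An independent dominating set of a graph $G$ is a set $S\subseteq V(G)$ of pairwise non-adjacent vertices such that every vertex not in $S$ has a neighbour in $S$. The independent domination number $\gamma_i(G)$ is the minimum size of an independent dominating set (for the null graph with no vertices, $\gamma_i=0$). The independent domination stability $st_{id}(G)$ is the minimum number of vertices whose removal from $G$ yields a graph with independent domination number different from $\gamma_i(G)$. $G-v$ denotes the graph obtained by deleting $v$ and its incident edges. -}

module Defs where

open import Data.Bool using (Bool; true; false; not)
open import Data.Nat using (ℕ; _≤_)
open import Data.Fin using (Fin)
open import Data.Fin.Subset using (Subset; _∈_; _∉_; ∣_∣; ⁅_⁆)
open import Data.List using (List; length; filterᵇ; allFin)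
open import Data.List.Base using (lookup)
open import Data.Vec using () renaming (lookup to vlookup)
open import Data.Product using (Σ; ∃; _×_; _,_)
open import Relation.Binary.PropositionalEquality using (_≡_; _≢_)

record Graph : Set where
  field
    n     : ℕ
    adj   : Fin n → Fin n → Bool
    sym   : ∀ u w → adj u w ≡ adj w u
    irrefl : ∀ u → adj u u ≡ false
open Graph public

induced : (G : Graph) → List (Fin (n G)) → Graph
induced G vs = record
  { n = length vs
  ; adj = λ i j → adj G (lookup vs i) (lookup vs j)
  ; sym = λ i j → sym G (lookup vs i) (lookup vs j)
  ; irrefl = λ i → irrefl G (lookup vs i)
  }

_∖_ : (G : Graph) → Subset (n G) → Graph
G ∖ X = induced G (filterᵇ (λ v → not (vlookup X v)) (allFin (n G)))

_─_ : (G : Graph) → Fin (n G) → Graph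
G ─ v = G ∖ ⁅ v ⁆

IsIndependent : (G : Graph) → Subset (n G) → Set
IsIndependent G S = ∀ u w → u ∈ S → w ∈ S → adj G u w ≡ false

IsDominating : (G : Graph) → Subset (n G) → Set
IsDominating G S = ∀ u → u ∉ S → ∃ λ w → w ∈ S × adj G u w ≡ true

IsIDS : (G : Graph) → Subset (n G) → Set
IsIDS G S = IsIndependent G S × IsDominating G S

-- "γ_i(G) = k": k is the minimum size of an independent dominating set.
-- (For the null graph the empty set is the only IDS, so γ_i = 0.)
IndDomNum : Graph → ℕ → Set
IndDomNum G k = (∃ λ S → IsIDS G S × ∣ S ∣ ≡ k) × (∀ S → IsIDS G S → k ≤ ∣ S ∣)

ChangesIndDom : (G : Graph) → Subset (n G) → Set
ChangesIndDom G X = ∀ a b → IndDomNum G a → IndDomNum (G ∖ X) b → a ≢ b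

-- "st_id(G) = s": s is the minimum number of vertices whose removal
-- changes γ_i.  (No such s exists for the null graph, i.e. st_id = ∞.)
IndDomStab : Graph → ℕ → Set
IndDomStab G s = (∃ λ X → ChangesIndDom G X × ∣ X ∣ ≡ s)
               × (∀ X → ChangesIndDom G X → s ≤ ∣ X ∣)

{-# OPTIONS --safe #-}
-- Let Y witness st_id(G - v) = t, and let X be Y together with v, so |X| = t + 1
-- and G - X = (G - v) - Y.  If deleting v alone changed γ_i, then st_id(G) ≤ 1.
-- Otherwise γ_i(G) = γ_i(G - v) ≠ γ_i((G - v) - Y) = γ_i(G - X), so X changes γ_i
-- and st_id(G) ≤ t + 1.  The case split is classical, so it is made under a double
-- negation, which is harmless because s ≤ t + 1 is decidable.
module Submission where

open import Defs
open import Data.Nat using (ℕ; _≤_; _+_; suc; _≤?_)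
open import Data.Fin using (Fin; zero; suc; cast)
open import Data.Nat.Properties using (≤-antisym; ≤-trans; +-comm; +-suc; m≤n+m)
open import Data.Fin.Properties using (cast-is-id)
open import Data.Fin.Subset using (Subset; ∣_∣; ⁅_⁆)
open import Data.Fin.Subset.Properties using (∣⁅x⁆∣≡1)
open import Data.Bool using (Bool; true; false; not)
open import Data.Vec using (Vec; []; _∷_) renaming (lookup to vlookup)
open import Data.List using (List; []; _∷_; map; length; filterᵇ; allFin; tabulate)
open import Data.List.Base using (lookup)
open import Data.List.Properties using (length-map)
open import Data.Product using (∃; _×_; _,_)
open import Relation.Nullary using (¬_)
open import Relation.Nullary.Decidable using (decidable-stable)
open import Relation.Binary.PropositionalEquality
  using (_≡_; refl; trans; cong; cong₂; subst; module ≡-Reasoning)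
  renaming (sym to ≡-sym)
open import Function using (_∘_; id)

outside : ∀ {k} {B : Set} → Vec Bool k → (Fin k → B) → List B
outside []          g = []
outside (true ∷ X)  g = outside X (g ∘ suc)
outside (false ∷ X) g = g zero ∷ outside X (g ∘ suc)

filterᵇ-tabulate : ∀ {k} {B : Set} (X : Vec Bool k) (g : Fin k → B) (p : B → Bool) →
  (∀ i → p (g i) ≡ not (vlookup X i)) → filterᵇ p (tabulate g) ≡ outside X g
filterᵇ-tabulate []          g p e = refl
filterᵇ-tabulate (true ∷ X)  g p e rewrite e zero = filterᵇ-tabulate X (g ∘ suc) p (e ∘ suc)
filterᵇ-tabulate (false ∷ X) g p e rewrite e zero =
  cong (g zero ∷_) (filterᵇ-tabulate X (g ∘ suc) p (e ∘ suc))

survivors : ∀ {k} → Subset k → List (Fin k)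
survivors {k} X = filterᵇ (not ∘ vlookup X) (allFin k)

survivors-outside : ∀ {k} (X : Subset k) → survivors X ≡ outside X id
survivors-outside X = filterᵇ-tabulate X id (not ∘ vlookup X) (λ _ → refl)

map-outside : ∀ {k} {B C : Set} (f : B → C) (X : Vec Bool k) (g : Fin k → B) →
  map f (outside X g) ≡ outside X (f ∘ g)
map-outside f []          g = refl
map-outside f (true ∷ X)  g = map-outside f X (g ∘ suc)
map-outside f (false ∷ X) g = cong (f (g zero) ∷_) (map-outside f X (g ∘ suc))

-- L is abstracted over (with an equation) so that the index of Y can stay fixed.
outside-outside : ∀ {k} {B : Set} (A : Subset k) (g : Fin k → B) (L : List B) →
  L ≡ outside A g → (Y : Subset (length L)) →
  ∃ λ X → outside Y (lookup L) ≡ outside X g × ∣ X ∣ ≡ ∣ A ∣ + ∣ Y ∣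
outside-outside []          g .[] refl [] = [] , refl , refl
outside-outside (true ∷ A)  g L e Y with outside-outside A (g ∘ suc) L e Y
... | X , eq , size = true ∷ X , eq , cong suc size
outside-outside (false ∷ A) g ._ refl (true ∷ Y)
  with outside-outside A (g ∘ suc) _ refl Y
... | X , eq , size = true ∷ X , eq , trans (cong suc size) (≡-sym (+-suc ∣ A ∣ ∣ Y ∣))
outside-outside (false ∷ A) g ._ refl (false ∷ Y)
  with outside-outside A (g ∘ suc) _ refl Y
... | X , eq , size = false ∷ X , cong (g zero ∷_) eq , size

lookup-map : ∀ {B C : Set} (f : B → C) (l : List B) (i : Fin (length (map f l))) →
  lookup (map f l) i ≡ f (lookup l (cast (length-map f l) i))
lookup-map f (x ∷ l) zero    = refl
lookup-map f (x ∷ l) (suc i) = lookup-map f l i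

IsIDS-≗ : ∀ {k} {a b : Fin k → Fin k → Bool} {sa sb ia ib} →
  (∀ i j → a i j ≡ b i j) → ∀ S →
  IsIDS (record { n = k ; adj = a ; sym = sa ; irrefl = ia }) S →
  IsIDS (record { n = k ; adj = b ; sym = sb ; irrefl = ib }) S
IsIDS-≗ a≗b S (independent , dominating) =
    (λ u w u∈S w∈S → trans (≡-sym (a≗b u w)) (independent u w u∈S w∈S))
  , (λ u u∉S → let (w , w∈S , uw) = dominating u u∉S in w , w∈S , trans (≡-sym (a≗b u w)) uw)

IndDomNum-relabel : ∀ {c} (H₁ H₂ : Graph) (p : n H₁ ≡ n H₂) →
  (∀ i j → adj H₁ i j ≡ adj H₂ (cast p i) (cast p j)) →
  IndDomNum H₁ c → IndDomNum H₂ c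
IndDomNum-relabel record { n = k ; adj = a ; sym = sa ; irrefl = ia }
                  record { n = .k ; adj = b ; sym = sb ; irrefl = ib } refl h
  ((S , ids , size) , minimal) =
      (S , IsIDS-≗ {sa = sa} {sb} {ia} {ib} a≗b S ids , size)
  , λ T ids′ → minimal T (IsIDS-≗ {sa = sb} {sa} {ib} {ia} (λ i j → ≡-sym (a≗b i j)) T ids′)
  where
  a≗b : ∀ i j → a i j ≡ b i j
  a≗b i j = trans (h i j) (cong₂ b (cast-is-id refl i) (cast-is-id refl j))

IndDomNum-induced-induced : ∀ {c} (G : Graph) (L : List (Fin (n G))) (l : List (Fin (length L))) →
  IndDomNum (induced G (map (lookup L) l)) c → IndDomNum (induced (induced G L) l) c
IndDomNum-induced-induced G L l =
  IndDomNum-relabel (induced G (map (lookup L) l)) (induced (induced G L) l) (length-map (lookup L) l)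
    (λ i j → cong₂ (adj G) (lookup-map (lookup L) l i) (lookup-map (lookup L) l j))

IndDomNum-unique : ∀ H {a b} → IndDomNum H a → IndDomNum H b → a ≡ b
IndDomNum-unique H ((S , idsS , ∣S∣≡a) , minA) ((T , idsT , ∣T∣≡b) , minB) =
  ≤-antisym (subst (_ ≤_) ∣T∣≡b (minA T idsT)) (subst (_ ≤_) ∣S∣≡a (minB S idsS))

IndDomNum-∖-∖ : (G : Graph) (A : Subset (n G)) (Y : Subset (n (G ∖ A))) →
  ∃ λ X → ∣ X ∣ ≡ ∣ A ∣ + ∣ Y ∣ × (∀ c → IndDomNum (G ∖ X) c → IndDomNum ((G ∖ A) ∖ Y) c)
IndDomNum-∖-∖ G A Y with outside-outside A id (survivors A) (survivors-outside A) Y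
... | X , eq , size = X , size , λ c →
  IndDomNum-induced-induced G L (survivors Y) ∘ subst (λ l → IndDomNum (induced G l) c) vertices
  where
  open ≡-Reasoning
  L = survivors A
  vertices : survivors X ≡ map (lookup L) (survivors Y)
  vertices = begin
    survivors X                   ≡⟨ survivors-outside X ⟩
    outside X id                  ≡⟨ ≡-sym eq ⟩
    outside Y (lookup L)          ≡⟨ ≡-sym (map-outside (lookup L) Y id) ⟩
    map (lookup L) (outside Y id) ≡⟨ cong (map (lookup L)) (≡-sym (survivors-outside Y)) ⟩
    map (lookup L) (survivors Y)  ∎

ChangesIndDom-∖ : (G : Graph) (A : Subset (n G)) (Y : Subset (n (G ∖ A))) →
  ChangesIndDom (G ∖ A) Y →
  ∃ λ X → ∣ X ∣ ≡ ∣ A ∣ + ∣ Y ∣ × (¬ ChangesIndDom G A → ChangesIndDom G X)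
ChangesIndDom-∖ G A Y changesY with IndDomNum-∖-∖ G A Y
... | X , size , sameNum = X , size , λ keepsA a c γG γG∖X a≡c →
  keepsA λ a′ b γG′ γG∖A a′≡b →
    changesY b c γG∖A (sameNum c γG∖X)
      (trans (≡-sym a′≡b) (trans (IndDomNum-unique G γG′ γG) a≡c))

mainTheorem5 : (G : Graph) (v : Fin (n G)) (s t : ℕ) →
    IndDomStab G s → IndDomStab (G ─ v) t → s ≤ t + 1
mainTheorem5 G v s t (_ , minimal) ((Y , changesY , ∣Y∣≡t) , _) =
  decidable-stable (s ≤? t + 1) λ s≰t+1 →
    let (X , size , lift) = ChangesIndDom-∖ G ⁅ v ⁆ Y changesY
        ∣X∣≡t+1 = trans size (trans (cong₂ _+_ (∣⁅x⁆∣≡1 v) ∣Y∣≡t) (+-comm 1 t))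
        keepsV : ¬ ChangesIndDom G ⁅ v ⁆
        keepsV changesV = s≰t+1 (≤-trans (minimal ⁅ v ⁆ changesV)
          (subst (_≤ t + 1) (≡-sym (∣⁅x⁆∣≡1 v)) (m≤n+m 1 t)))
    in s≰t+1 (subst (s ≤_) ∣X∣≡t+1 (minimal X (lift keepsV)))
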